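{- For all positive integers $m$ and $n$ satisfying $m\leq\binom{n}{2}$ there is a simple graph $G$ with $n$ vertices and $m$ edges whose rectilinear space crossing number satisfies $\overline{\mathrm{cr}}_4(G)\leq 6720\, m^6/n^4$.
   Context: A straight-line spatial drawing of a graph $G$ represents the vertices by distinct points of $\mathbb{R}^3$ and each edge by the straight-line segment joining the points of its endpoints. A space crossing in such a drawing consists of four pairwise vertex-disjoint edges together with a line in $\mathbb{R}^3$ meeting all four segments; space crossings are counted by the quadruples of edges for which such a line exists. The rectilinear space crossing number $\overline{\mathrm{cr}}_4(G)$ is the least number of space crossings over all straight-line spatial drawings of $G$. -}

module Defs where

open import Level using (0ℓ)
open import Data.Nat as ℕ using (ℕ)
open import Data.Fin using (Fin) renaming (_<_ to _<ᶠ_)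
open import Data.Product using (Σ; ∃; _×_; _,_; proj₁; proj₂)
open import Data.Sum using (_⊎_)
open import Relation.Nullary using (¬_)
open import Relation.Binary.PropositionalEquality using (_≡_; _≢_)
open import Relation.Binary.Core using (Rel)
open import Relation.Binary.Structures using (IsStrictTotalOrder)
open import Algebra.Structures using (IsCommutativeRing)

-- The real numbers, axiomatised as a complete ordered field
-- (unique up to isomorphism; theorems are stated for every model).

record CompleteOrderedField : Set₁ where
  infixl 6 _+_ _-_
  infixl 7 _*_
  infix 4 _≈_ _<_ _≤_
  field
    Carrier : Set
    _≈_     : Rel Carrier 0ℓ
    _+_ _*_ : Carrier → Carrier → Carrier
    -_      : Carrier → Carrier
    0# 1#   : Carrier
    _<_     : Rel Carrier 0ℓ
    isCommutativeRing  : IsCommutativeRing _≈_ _+_ _*_ -_ 0# 1#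
    0≉1                : ¬ (0# ≈ 1#)
    inverse            : ∀ x → ¬ (x ≈ 0#) → ∃ λ y → x * y ≈ 1#
    isStrictTotalOrder : IsStrictTotalOrder _≈_ _<_
    +-mono-<           : ∀ {x y} z → x < y → x + z < y + z
    *-pos              : ∀ {x y} → 0# < x → 0# < y → 0# < x * y

  _-_ : Carrier → Carrier → Carrier
  x - y = x + (- y)

  _≤_ : Rel Carrier 0ℓ
  x ≤ y = x < y ⊎ x ≈ y

  IsUpperBound : (Carrier → Set) → Carrier → Set
  IsUpperBound P b = ∀ x → P x → x ≤ b

  field
    sup : (P : Carrier → Set) → ∃ P → ∃ (IsUpperBound P) →
          ∃ λ s → IsUpperBound P s × (∀ b → IsUpperBound P b → s ≤ b)

-- Simple graphs with vertex set Fin n and exactly m edges: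
-- an injective enumeration of the edges, each edge {i , j} with i < j.

record SimpleGraph (n m : ℕ) : Set where
  field
    edge     : Fin m → Fin n × Fin n
    ordered  : ∀ e → proj₁ (edge e) <ᶠ proj₂ (edge e)
    injEdges : ∀ e f → edge e ≡ edge f → e ≡ f

module Space (R : CompleteOrderedField) where
  open CompleteOrderedField R

  Point : Set
  Point = Carrier × Carrier × Carrier

  _≈³_ : Point → Point → Set
  (x₁ , y₁ , z₁) ≈³ (x₂ , y₂ , z₂) = x₁ ≈ x₂ × y₁ ≈ y₂ × z₁ ≈ z₂

  _+³_ : Point → Point → Point
  (x₁ , y₁ , z₁) +³ (x₂ , y₂ , z₂) = (x₁ + x₂ , y₁ + y₂ , z₁ + z₂)

  _-³_ : Point → Point → Point
  (x₁ , y₁ , z₁) -³ (x₂ , y₂ , z₂) = (x₁ - x₂ , y₁ - y₂ , z₁ - z₂)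

  _·³_ : Carrier → Point → Point
  t ·³ (x , y , z) = (t * x , t * y , t * z)

  origin : Point
  origin = (0# , 0# , 0#)

  -- A line {q + s v : s ∈ R} with v ≠ 0.
  Line : Set
  Line = Σ Point λ q → Σ Point λ v → ¬ (v ≈³ origin)

  MeetsSegment : Line → Point → Point → Set
  MeetsSegment (q , v , _) a b =
    Σ Carrier λ t → Σ Carrier λ s →
      (0# ≤ t) × (t ≤ 1#) × ((a +³ (t ·³ (b -³ a))) ≈³ (q +³ (s ·³ v)))

record Drawing (R : CompleteOrderedField) (n : ℕ) : Set where
  open Space R
  field
    pos      : Fin n → Point
    distinct : ∀ i j → i ≢ j → ¬ (pos i ≈³ pos j)

-- Quadruples of edge indices; a set of four edges is represented by the
-- unique strictly increasing quadruple of its indices.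
Quad : ℕ → Set
Quad m = Fin m × Fin m × Fin m × Fin m

module _ {R : CompleteOrderedField} {n m : ℕ} where
  open Space R

  VertexDisjoint : SimpleGraph n m → Fin m → Fin m → Set
  VertexDisjoint G e f =
    let (a , b) = SimpleGraph.edge G e
        (c , d) = SimpleGraph.edge G f
    in a ≢ c × a ≢ d × b ≢ c × b ≢ d

  segStart segEnd : SimpleGraph n m → Drawing R n → Fin m → Point
  segStart G D e = Drawing.pos D (proj₁ (SimpleGraph.edge G e))
  segEnd   G D e = Drawing.pos D (proj₂ (SimpleGraph.edge G e))

  MeetsEdge : SimpleGraph n m → Drawing R n → Line → Fin m → Set
  MeetsEdge G D ℓ e = MeetsSegment ℓ (segStart G D e) (segEnd G D e)

  -- A space crossing: four pairwise vertex-disjoint edges (listed in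
  -- increasing index order, so each 4-set counted once) and a line
  -- meeting all four segments.
  IsSpaceCrossing : SimpleGraph n m → Drawing R n → Quad m → Set
  IsSpaceCrossing G D (e₁ , e₂ , e₃ , e₄) =
    (e₁ <ᶠ e₂ × e₂ <ᶠ e₃ × e₃ <ᶠ e₄)
    × (VertexDisjoint G e₁ e₂ × VertexDisjoint G e₁ e₃ × VertexDisjoint G e₁ e₄
       × VertexDisjoint G e₂ e₃ × VertexDisjoint G e₂ e₄ × VertexDisjoint G e₃ e₄)
    × Σ Line λ ℓ → MeetsEdge G D ℓ e₁ × MeetsEdge G D ℓ e₂
                   × MeetsEdge G D ℓ e₃ × MeetsEdge G D ℓ e₄

module Submission where

-- Vertices are split into blocks of k vertices; vertex i of block b sits at (k b² + i, 0, b), and up to C(k,2)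
-- edges are drawn inside each block, so the edges of block b lie on the row segment [k b², k b² + k - 1] × {b}
-- of the xz-plane. Points (k b² + δ, b) with 0 ≤ δ < k hug a parabola, so no three in distinct rows are
-- collinear: a line meets the edges of at most two blocks. Hence every space crossing is a quadruple of edges
-- from at most two blocks, and there are at most m · B · (2 C(k,2))³ of these. With k = ⌈4m/n⌉ and
-- B = ⌈m / C(k,2)⌉ blocks this is at most 2304 m⁶/n⁴ when n < 2m and n² > 81m; if 2m ≤ n a matching has no
-- space crossing at all, and if n² ≤ 81m the trivial bound m⁴ already suffices.

open import Defs

module ListCounting where

  open import Data.Nat using (ℕ; _*_; _≤_; z≤n; s≤s)
  open import Data.Nat.Properties using (≤-trans; ≤-reflexive; +-mono-≤)
  open import Data.Product using (_×_; _,_)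
  open import Data.List using (List; []; _∷_; map; concatMap; length)
  open import Data.List.Properties using (length-++; length-map)
  open import Data.List.Membership.Propositional using (_∈_; lose)
  open import Data.List.Membership.Propositional.Properties using (∈-concatMap⁺; ∈-map⁺)

  length-concatMap-≤ : ∀ {A B : Set} (f : A → List B) {a c : ℕ} (xs : List A) →
                       (∀ x → length (f x) ≤ c) → length xs ≤ a → length (concatMap f xs) ≤ a * c
  length-concatMap-≤ f [] _ _ = z≤n
  length-concatMap-≤ f (x ∷ xs) fx≤c (s≤s |xs|≤a) =
    ≤-trans (≤-reflexive (length-++ (f x))) (+-mono-≤ (fx≤c x) (length-concatMap-≤ f xs fx≤c |xs|≤a))

  quadruplesWith : ∀ {A : Set} → A → List A → List (A × A × A × A)
  quadruplesWith x xs = concatMap (λ y → concatMap (λ z → map (λ u → (x , y , z , u)) xs) xs) xs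

  length-quadruplesWith : ∀ {A : Set} (x : A) {c} (xs : List A) → length xs ≤ c →
                          length (quadruplesWith x xs) ≤ c * (c * c)
  length-quadruplesWith x xs |xs|≤c =
    length-concatMap-≤ _ xs
      (λ y → length-concatMap-≤ _ xs (λ z → ≤-trans (≤-reflexive (length-map _ xs)) |xs|≤c) |xs|≤c) |xs|≤c

  ∈-quadruplesWith : ∀ {A : Set} (x : A) {y z u : A} {xs : List A} → y ∈ xs → z ∈ xs → u ∈ xs →
                     (x , y , z , u) ∈ quadruplesWith x xs
  ∈-quadruplesWith x y∈ z∈ u∈ = ∈-concatMap⁺ _ (lose y∈ (∈-concatMap⁺ _ (lose z∈ (∈-map⁺ _ u∈))))

module TwoValues where

  open import Data.Product using (Σ; _×_; _,_)
  open import Data.Sum using (_⊎_; inj₁; inj₂)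
  open import Data.Empty using (⊥; ⊥-elim)
  open import Relation.Nullary using (yes; no)
  open import Relation.Binary.Definitions using (DecidableEquality)
  open import Relation.Binary.PropositionalEquality using (_≡_; _≢_; refl; sym)

  module _ {A : Set} where

    NotPairwiseDistinct : A → A → A → Set
    NotPairwiseDistinct a b c = a ≢ b → b ≢ c → a ≢ c → ⊥

    TwoValued : A → A → A → A → Set
    TwoValued a b c d = Σ A λ x → (x ≡ b ⊎ x ≡ c ⊎ x ≡ d)
                                × (b ≡ a ⊎ b ≡ x) × (c ≡ a ⊎ c ≡ x) × (d ≡ a ⊎ d ≡ x)

    module _ (_≟_ : DecidableEquality A) where

      private
        other : ∀ a b c → NotPairwiseDistinct a b c → b ≢ a → c ≡ a ⊎ c ≡ b
        other a b c not-distinct b≢a with c ≟ a | c ≟ b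
        ... | yes c≡a | _ = inj₁ c≡a
        ... | no _ | yes c≡b = inj₂ c≡b
        ... | no c≢a | no c≢b =
          ⊥-elim (not-distinct (λ a≡b → b≢a (sym a≡b)) (λ b≡c → c≢b (sym b≡c)) (λ a≡c → c≢a (sym a≡c)))

      two-valued : ∀ a b c d → NotPairwiseDistinct a b c → NotPairwiseDistinct a b d → NotPairwiseDistinct a c d →
                   TwoValued a b c d
      two-valued a b c d abc abd acd with b ≟ a
      ... | no b≢a = b , inj₁ refl , inj₂ refl , other a b c abc b≢a , other a b d abd b≢a
      ... | yes b≡a with c ≟ a
      ...   | no c≢a = c , inj₂ (inj₁ refl) , inj₁ b≡a , inj₂ refl , other a c d acd c≢a
      ...   | yes c≡a = d , inj₂ (inj₂ refl) , inj₁ b≡a , inj₁ c≡a , inj₂ refl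

module PairEnumeration where

  open import Data.Nat using (ℕ; zero; suc; _+_; _*_; _∸_; _≤_; _<_; _<?_)
  open import Data.Nat.Properties
  open import Data.Nat.Combinatorics using (_C_; nC1≡n; nCk+nC[k+1]≡[n+1]C[k+1])
  open import Data.Product using (_×_; _,_; proj₁; proj₂)
  open import Relation.Nullary using (yes; no)
  open import Relation.Binary.PropositionalEquality using (_≡_; refl; sym; trans; cong; cong₂; subst; module ≡-Reasoning)
  open import Data.List using ([]; _∷_)
  open import Data.Nat.Tactic.RingSolver using (solve-∀; solve)

  triangular : ℕ → ℕ
  triangular zero = 0
  triangular (suc k) = triangular k + k

  triangular≡C2 : ∀ n → triangular n ≡ n C 2
  triangular≡C2 zero = refl
  triangular≡C2 (suc n) = begin
    triangular n + n     ≡⟨ cong₂ _+_ (triangular≡C2 n) (sym (nC1≡n n)) ⟩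
    n C 2 + n C 1        ≡⟨ +-comm (n C 2) (n C 1) ⟩
    n C 1 + n C 2        ≡⟨ nCk+nC[k+1]≡[n+1]C[k+1] n 1 ⟩
    suc n C 2            ∎
    where open ≡-Reasoning

  triangular-double : ∀ w → triangular (suc w) + triangular (suc w) ≡ w * suc w
  triangular-double zero = refl
  triangular-double (suc w) = begin
    (T + suc w) + (T + suc w) ≡⟨ regroup T w ⟩
    (T + T) + 2 * suc w       ≡⟨ cong (_+ 2 * suc w) (triangular-double w) ⟩
    w * suc w + 2 * suc w     ≡⟨ solve (w ∷ []) ⟩
    suc w * suc (suc w)       ∎
    where
    open ≡-Reasoning
    T : ℕ
    T = triangular (suc w)
    regroup : ∀ t w → (t + suc w) + (t + suc w) ≡ (t + t) + 2 * suc w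
    regroup = solve-∀

  -- The r-th pair (i , j) with i < j in colexicographic order (0,1), (0,2), (1,2), (0,3), …
  unrankPair : ℕ → ℕ → ℕ × ℕ
  unrankPair zero r = (0 , 0)
  unrankPair (suc k) r with r <? triangular k
  ... | yes _ = unrankPair k r
  ... | no _ = (r ∸ triangular k , k)

  rankOf : ℕ × ℕ → ℕ
  rankOf (i , j) = triangular j + i

  RankedPair : ℕ → ℕ → ℕ × ℕ → Set
  RankedPair k r (i , j) = i < j × j < k × rankOf (i , j) ≡ r

  unrankPair-ranked : ∀ k r → r < triangular k → RankedPair k r (unrankPair k r)
  unrankPair-ranked (suc k) r r< with r <? triangular k
  ... | yes r<T = let (i<j , j<k , rank) = unrankPair-ranked k r r<T in i<j , m<n⇒m<1+n j<k , rank
  ... | no r≮T = i<k , n<1+n k , m+[n∸m]≡n T≤r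
    where
    T≤r : triangular k ≤ r
    T≤r = ≮⇒≥ r≮T
    i<k : r ∸ triangular k < k
    i<k = +-cancelˡ-< (triangular k) (r ∸ triangular k) k (subst (_< triangular k + k) (sym (m+[n∸m]≡n T≤r)) r<)

  unrankPair-injective : ∀ k {r r'} → r < triangular k → r' < triangular k →
                         unrankPair k r ≡ unrankPair k r' → r ≡ r'
  unrankPair-injective k {r} {r'} r< r'< eq =
    trans (sym (proj₂ (proj₂ (unrankPair-ranked k r r<)))) (trans (cong rankOf eq) (proj₂ (proj₂ (unrankPair-ranked k r' r'<))))

module QuotientRemainder where

  open import Data.Nat using (_+_; _*_; _<_; NonZero)
  open import Data.Nat.DivMod using (_/_; _%_; [m+kn]%n≡m%n; m<n⇒m%n≡m; m<n⇒m/n≡0; m*n/n≡m; +-distrib-/-∣ʳ)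
  open import Data.Nat.Divisibility using (divides-refl)
  open import Data.Product using (_×_; _,_)
  open import Relation.Binary.PropositionalEquality using (_≡_; sym; trans; cong; cong₂; module ≡-Reasoning)

  [m+kn]/n≡k : ∀ {m} k n .{{_ : NonZero n}} → m < n → (m + k * n) / n ≡ k
  [m+kn]/n≡k {m} k n m<n = begin
    (m + k * n) / n       ≡⟨ +-distrib-/-∣ʳ m (divides-refl k) ⟩
    m / n + k * n / n     ≡⟨ cong₂ _+_ (m<n⇒m/n≡0 m<n) (m*n/n≡m k n) ⟩
    k                     ∎
    where open ≡-Reasoning

  [m+kn]%n≡m : ∀ {m} k n .{{_ : NonZero n}} → m < n → (m + k * n) % n ≡ m
  [m+kn]%n≡m {m} k n m<n = trans ([m+kn]%n≡m%n m k n) (m<n⇒m%n≡m m<n)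

  +-*-injective : ∀ {m m'} k k' n .{{_ : NonZero n}} → m < n → m' < n → m + k * n ≡ m' + k' * n → k ≡ k' × m ≡ m'
  +-*-injective k k' n m<n m'<n eq =
    trans (sym ([m+kn]/n≡k k n m<n)) (trans (cong (_/ n) eq) ([m+kn]/n≡k k' n m'<n)) ,
    trans (sym ([m+kn]%n≡m k n m<n)) (trans (cong (_% n) eq) ([m+kn]%n≡m k' n m'<n))

module BlockArithmetic where

  open PairEnumeration using (triangular; triangular-double)

  open import Data.Nat
  open import Data.Nat.Properties
  open import Data.Product using (∃; _×_; _,_)
  open import Data.Empty using (⊥-elim)
  open import Data.Sum using (inj₁; inj₂)
  open import Data.List using ([]; _∷_)
  open import Relation.Binary.PropositionalEquality using (_≡_; sym; cong; subst)
  open import Data.Nat.Tactic.RingSolver using (solve)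

  ∃-multiple-between : ∀ a d → 0 < d → ∃ λ q → a ≤ q * d × q * d < a + d
  ∃-multiple-between zero d d>0 = 0 , z≤n , d>0
  ∃-multiple-between (suc a) d d>0 with ∃-multiple-between a d d>0
  ... | q , a≤qd , qd<a+d with m≤n⇒m<n∨m≡n a≤qd
  ...   | inj₁ a<qd = q , a<qd , <-trans qd<a+d (n<1+n (a + d))
  ...   | inj₂ a≡qd = suc q , subst (λ x → suc x ≤ d + q * d) (sym a≡qd) (+-monoˡ-≤ (q * d) d>0) ,
                      subst (λ x → d + x < suc (a + d)) a≡qd (≤-reflexive (cong suc (+-comm d a)))

  -- The block size is k = 3 + V = ⌈4m/n⌉, at least 3 because n < 2m.
  module Sparse {m n V : ℕ} (m≥1 : 1 ≤ m) (n<2m : n < 2 * m) (81m<n² : 81 * m < n * n)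
                (4m≤kn : 4 * m ≤ (3 + V) * n) (kn<4m+n : (3 + V) * n < 4 * m + n) where

    open ≤-Reasoning

    [2+V]n<4m : (2 + V) * n < 4 * m
    [2+V]n<4m = +-cancelˡ-< n ((2 + V) * n) (4 * m) (subst (suc (n + (2 + V) * n) ≤_) (+-comm (4 * m) n) kn<4m+n)

    81[2+V]<4n : 81 * (2 + V) < 4 * n
    81[2+V]<4n = *-cancelʳ-< n (81 * (2 + V)) (4 * n) (begin-strict
      81 * (2 + V) * n  ≡⟨ *-assoc 81 (2 + V) n ⟩
      81 * ((2 + V) * n) <⟨ *-monoʳ-< 81 [2+V]n<4m ⟩
      81 * (4 * m)       ≡⟨ solve (m ∷ []) ⟩
      4 * (81 * m)       <⟨ *-monoʳ-< 4 81m<n² ⟩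
      4 * (n * n)        ≡⟨ sym (*-assoc 4 n n) ⟩
      4 * n * n          ∎)

    20[2+V]≤n : 20 * (2 + V) ≤ n
    20[2+V]≤n = <⇒≤ (*-cancelˡ-< 4 (20 * (2 + V)) n (begin-strict
      4 * (20 * (2 + V)) ≡⟨ solve (V ∷ []) ⟩
      80 * (2 + V)       ≤⟨ *-monoˡ-≤ (2 + V) (≤ᵇ⇒≤ 80 81 _) ⟩
      81 * (2 + V)       <⟨ 81[2+V]<4n ⟩
      4 * n              ∎))

    2[2+V]²≤[1+V]n : 2 * ((2 + V) * (2 + V)) ≤ (1 + V) * n
    2[2+V]²≤[1+V]n = begin
      2 * ((2 + V) * (2 + V))             ≤⟨ *-monoʳ-≤ 2 (*-monoʳ-≤ (2 + V) (m≤m+n (2 + V) (9 * V + 8))) ⟩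
      2 * ((2 + V) * ((2 + V) + (9 * V + 8))) ≡⟨ solve (V ∷ []) ⟩
      (1 + V) * (20 * (2 + V))            ≤⟨ *-monoʳ-≤ (1 + V) 20[2+V]≤n ⟩
      (1 + V) * n                         ∎

    2m+[2+V]²≤[2+V]n : 2 * m + (2 + V) * (2 + V) ≤ (2 + V) * n
    2m+[2+V]²≤[2+V]n = *-cancelˡ-≤ 2 (begin
      2 * (2 * m + (2 + V) * (2 + V))     ≡⟨ solve (m ∷ V ∷ []) ⟩
      4 * m + 2 * ((2 + V) * (2 + V))     ≤⟨ +-mono-≤ 4m≤kn 2[2+V]²≤[1+V]n ⟩
      (3 + V) * n + (1 + V) * n           ≡⟨ solve (V ∷ n ∷ []) ⟩
      2 * ((2 + V) * n)                   ∎)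

    kn≤6m : (3 + V) * n ≤ 6 * m
    kn≤6m = <⇒≤ (begin-strict
      (3 + V) * n <⟨ kn<4m+n ⟩
      4 * m + n   <⟨ +-monoʳ-< (4 * m) n<2m ⟩
      4 * m + 2 * m ≡⟨ solve (m ∷ []) ⟩
      6 * m       ∎)

    module Blocks {E B : ℕ} (2E≡ : E + E ≡ (2 + V) * (3 + V)) (m≤BE : m ≤ B * E) (BE<m+E : B * E < m + E) where

      Bk≤n : B * (3 + V) ≤ n
      Bk≤n = ≤-pred (*-cancelˡ-< (2 + V) (B * (3 + V)) (suc n) (begin-strict
        (2 + V) * (B * (3 + V))            ≡⟨ solve (B ∷ V ∷ []) ⟩
        B * ((2 + V) * (3 + V))            ≡⟨ cong (B *_) (sym 2E≡) ⟩
        B * (E + E)                        ≡⟨ *-distribˡ-+ B E E ⟩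
        B * E + B * E                      <⟨ +-mono-< BE<m+E BE<m+E ⟩
        (m + E) + (m + E)                  ≡⟨ solve (m ∷ E ∷ []) ⟩
        2 * m + (E + E)                    ≡⟨ cong (2 * m +_) 2E≡ ⟩
        2 * m + (2 + V) * (3 + V)          ≡⟨ solve (m ∷ V ∷ []) ⟩
        (2 * m + (2 + V) * (2 + V)) + (2 + V) ≤⟨ +-monoˡ-≤ (2 + V) 2m+[2+V]²≤[2+V]n ⟩
        (2 + V) * n + (2 + V)              ≡⟨ solve (V ∷ n ∷ []) ⟩
        (2 + V) * suc n                    ∎))

      [E+E]n²≤24m² : (E + E) * (n * n) ≤ 24 * (m * m)
      [E+E]n²≤24m² = begin
        (E + E) * (n * n)                  ≡⟨ cong (_* (n * n)) 2E≡ ⟩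
        (2 + V) * (3 + V) * (n * n)        ≡⟨ solve (V ∷ n ∷ []) ⟩
        ((3 + V) * n) * ((2 + V) * n)      ≤⟨ *-mono-≤ kn≤6m (<⇒≤ [2+V]n<4m) ⟩
        (6 * m) * (4 * m)                  ≡⟨ solve (m ∷ []) ⟩
        24 * (m * m)                       ∎

      E+E≤m : E + E ≤ m
      E+E≤m = *-cancelʳ-≤ (E + E) m (81 * m) {{>-nonZero (<-≤-trans (s≤s z≤n) (*-monoʳ-≤ 81 m≥1))}} (begin
        (E + E) * (81 * m)                 ≤⟨ *-monoʳ-≤ (E + E) (<⇒≤ 81m<n²) ⟩
        (E + E) * (n * n)                  ≤⟨ [E+E]n²≤24m² ⟩
        24 * (m * m)                       ≤⟨ *-monoˡ-≤ (m * m) (≤ᵇ⇒≤ 24 81 _) ⟩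
        81 * (m * m)                       ≡⟨ solve (m ∷ []) ⟩
        m * (81 * m)                       ∎)

      B[E+E]≤4m : B * (E + E) ≤ 4 * m
      B[E+E]≤4m = begin
        B * (E + E)                        ≡⟨ *-distribˡ-+ B E E ⟩
        B * E + B * E                      ≤⟨ +-mono-≤ BE≤2m BE≤2m ⟩
        (m + m) + (m + m)                  ≡⟨ solve (m ∷ []) ⟩
        4 * m                              ∎
        where
        BE≤2m : B * E ≤ m + m
        BE≤2m = <⇒≤ (<-≤-trans BE<m+E (+-monoʳ-≤ m (≤-trans (m≤m+n E E) E+E≤m)))

      candidates-bound : m * (B * ((E + E) * ((E + E) * (E + E)))) * n ^ 4 ≤ 6720 * m ^ 6
      candidates-bound = begin
        m * (B * ((E + E) * ((E + E) * (E + E)))) * (n * (n * (n * (n * 1))))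
          ≡⟨ solve (m ∷ B ∷ E ∷ n ∷ []) ⟩
        m * (B * (E + E)) * (((E + E) * (n * n)) * ((E + E) * (n * n)))
          ≤⟨ *-mono-≤ (*-monoʳ-≤ m B[E+E]≤4m) (*-mono-≤ [E+E]n²≤24m² [E+E]n²≤24m²) ⟩
        m * (4 * m) * ((24 * (m * m)) * (24 * (m * m)))
          ≡⟨ solve (m ∷ []) ⟩
        2304 * (m * (m * (m * (m * (m * (m * 1))))))
          ≤⟨ *-monoˡ-≤ (m ^ 6) (≤ᵇ⇒≤ 2304 6720 _) ⟩
        6720 * m ^ 6 ∎

  sparse-block-size : ∀ {m n} → 1 ≤ m → 1 ≤ n → n < 2 * m →
                      ∃ λ V → 4 * m ≤ (3 + V) * n × (3 + V) * n < 4 * m + n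
  sparse-block-size {m} {n} m≥1 n≥1 n<2m with ∃-multiple-between (4 * m) n n≥1
  ... | 0 , 4m≤0 , _ = ⊥-elim (<⇒≱ (*-monoʳ-< 4 m≥1) 4m≤0)
  ... | 1 , 4m≤n , _ =
    ⊥-elim (<⇒≱ (<-≤-trans n<2m (*-monoˡ-≤ m (≤ᵇ⇒≤ 2 4 _))) (≤-trans 4m≤n (≤-reflexive (+-identityʳ n))))
  ... | 2 , 4m≤2n , _ = ⊥-elim (<⇒≱ (subst (2 * n <_) (sym (*-assoc 2 2 m)) (*-monoʳ-< 2 n<2m)) 4m≤2n)
  ... | suc (suc (suc V)) , 4m≤kn , kn<4m+n = V , 4m≤kn , kn<4m+n

  record BlockDesign (m n : ℕ) : Set where
    field
      w blocks      : ℕ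
      pairs-nonZero : NonZero (triangular (suc w))
      blocks-fit    : blocks * suc w ≤ n
      edges-fit     : m ≤ blocks * triangular (suc w)
      few-candidates : let E = triangular (suc w) in
                       m * (blocks * ((E + E) * ((E + E) * (E + E)))) * n ^ 4 ≤ 6720 * m ^ 6

  triangular-[3+V]>0 : ∀ V → 0 < triangular (3 + V)
  triangular-[3+V]>0 V = <-≤-trans (s≤s z≤n) (m≤n+m (2 + V) (triangular (2 + V)))

  sparse-design : ∀ {m n} → 1 ≤ m → 1 ≤ n → n < 2 * m → 81 * m < n * n → BlockDesign m n
  sparse-design {m} {n} m≥1 n≥1 n<2m 81m<n² with sparse-block-size m≥1 n≥1 n<2m
  ... | V , 4m≤kn , kn<4m+n with ∃-multiple-between m (triangular (3 + V)) (triangular-[3+V]>0 V)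
  ...   | B , m≤BE , BE<m+E = record
    { w = 2 + V ; blocks = B ; pairs-nonZero = >-nonZero (triangular-[3+V]>0 V)
    ; blocks-fit = Bk≤n ; edges-fit = m≤BE ; few-candidates = candidates-bound }
    where open Sparse.Blocks m≥1 n<2m 81m<n² 4m≤kn kn<4m+n {B = B} (triangular-double (2 + V)) m≤BE BE<m+E

  dense-bound : ∀ m n → n * n ≤ 81 * m → m * (m * (m * m)) * n ^ 4 ≤ 6720 * m ^ 6
  dense-bound m n n²≤81m = begin
    m * (m * (m * m)) * (n * (n * (n * (n * 1)))) ≡⟨ solve (m ∷ n ∷ []) ⟩
    (m * m * m * m) * ((n * n) * (n * n))         ≤⟨ *-monoʳ-≤ (m * m * m * m) (*-mono-≤ n²≤81m n²≤81m) ⟩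
    (m * m * m * m) * ((81 * m) * (81 * m))       ≡⟨ solve (m ∷ []) ⟩
    6561 * (m * (m * (m * (m * (m * (m * 1))))))  ≤⟨ *-monoˡ-≤ (m ^ 6) (≤ᵇ⇒≤ 6561 6720 _) ⟩
    6720 * m ^ 6                                  ∎
    where open ≤-Reasoning

module IntegerDifferences where

  open import Data.Nat as ℕ using (ℕ; suc)
  import Data.Nat.Properties as ℕ
  open import Data.Integer as ℤ using (ℤ; +_; -[1+_])
  import Data.Integer.Properties as ℤ
  open import Data.Integer.Tactic.RingSolver using (solve-∀)
  open import Relation.Binary.PropositionalEquality using (_≡_; sym; trans; cong; cong₂; module ≡-Reasoning)
  open ≡-Reasoning

  positivePart negativePart : ℤ → ℕ
  positivePart (+ n) = n
  positivePart -[1+ n ] = 0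
  negativePart (+ n) = 0
  negativePart -[1+ n ] = suc n

  parts : ∀ i → i ℤ.+ + negativePart i ≡ + positivePart i
  parts (+ n) = cong +_ (ℕ.+-identityʳ n)
  parts -[1+ n ] = ℤ.+-inverseˡ (+ suc n)

  difference : ∀ i {p q} → i ℤ.+ + q ≡ + p → i ≡ + p ℤ.- + q
  difference i {p} {q} eq = trans (sub-add i (+ q)) (cong (ℤ._- + q) eq)
    where
    sub-add : ∀ i j → i ≡ (i ℤ.+ j) ℤ.- j
    sub-add = solve-∀

  +-difference : ∀ i j {p q p' q'} → i ℤ.+ + q ≡ + p → j ℤ.+ + q' ≡ + p' →
                 (i ℤ.+ j) ℤ.+ + (q ℕ.+ q') ≡ + (p ℕ.+ p')
  +-difference i j {p} {q} {p'} {q'} eq eq' = begin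
    (i ℤ.+ j) ℤ.+ + (q ℕ.+ q')     ≡⟨ cong (λ x → (i ℤ.+ j) ℤ.+ x) (ℤ.pos-+ q q') ⟩
    (i ℤ.+ j) ℤ.+ (+ q ℤ.+ + q')   ≡⟨ interchange i j (+ q) (+ q') ⟩
    (i ℤ.+ + q) ℤ.+ (j ℤ.+ + q')   ≡⟨ cong₂ ℤ._+_ eq eq' ⟩
    + p ℤ.+ + p'                   ≡⟨ sym (ℤ.pos-+ p p') ⟩
    + (p ℕ.+ p')                   ∎
    where
    interchange : ∀ a b c d → (a ℤ.+ b) ℤ.+ (c ℤ.+ d) ≡ (a ℤ.+ c) ℤ.+ (b ℤ.+ d)
    interchange = solve-∀

  *-difference : ∀ i j {p q p' q'} → i ℤ.+ + q ≡ + p → j ℤ.+ + q' ≡ + p' →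
                 (i ℤ.* j) ℤ.+ + (p ℕ.* q' ℕ.+ q ℕ.* p') ≡ + (p ℕ.* p' ℕ.+ q ℕ.* q')
  *-difference i j {p} {q} {p'} {q'} eq eq' = begin
    (i ℤ.* j) ℤ.+ + (p ℕ.* q' ℕ.+ q ℕ.* p')
      ≡⟨ cong₂ (λ a b → (a ℤ.* b) ℤ.+ + (p ℕ.* q' ℕ.+ q ℕ.* p')) (difference i eq) (difference j eq') ⟩
    ((+ p ℤ.- + q) ℤ.* (+ p' ℤ.- + q')) ℤ.+ + (p ℕ.* q' ℕ.+ q ℕ.* p')
      ≡⟨ cong (λ x → ((+ p ℤ.- + q) ℤ.* (+ p' ℤ.- + q')) ℤ.+ x) (+-of-*+* p q' q p') ⟩
    ((+ p ℤ.- + q) ℤ.* (+ p' ℤ.- + q')) ℤ.+ (+ p ℤ.* + q' ℤ.+ + q ℤ.* + p')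
      ≡⟨ expand (+ p) (+ q) (+ p') (+ q') ⟩
    + p ℤ.* + p' ℤ.+ + q ℤ.* + q'
      ≡⟨ sym (+-of-*+* p p' q q') ⟩
    + (p ℕ.* p' ℕ.+ q ℕ.* q') ∎
    where
    +-of-*+* : ∀ a b c d → + (a ℕ.* b ℕ.+ c ℕ.* d) ≡ + a ℤ.* + b ℤ.+ + c ℤ.* + d
    +-of-*+* a b c d = trans (ℤ.pos-+ (a ℕ.* b) (c ℕ.* d)) (cong₂ ℤ._+_ (ℤ.pos-* a b) (ℤ.pos-* c d))
    expand : ∀ a b c d → ((a ℤ.- b) ℤ.* (c ℤ.- d)) ℤ.+ (a ℤ.* d ℤ.+ b ℤ.* c) ≡ a ℤ.* c ℤ.+ b ℤ.* d
    expand = solve-∀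

  neg-difference : ∀ i {p q} → i ℤ.+ + q ≡ + p → ℤ.- i ℤ.+ + p ≡ + q
  neg-difference i {p} {q} eq = trans (cong (λ a → ℤ.- a ℤ.+ + p) (difference i eq)) (cancel (+ p) (+ q))
    where
    cancel : ∀ a b → ℤ.- (a ℤ.- b) ℤ.+ a ≡ b
    cancel = solve-∀

module OrderedFieldLemmas (R : CompleteOrderedField) where

  open import Level using (0ℓ)

  open import Data.Nat as ℕ using (ℕ; zero; suc)
  import Data.Nat.Properties as ℕ
  open import Data.Integer as ℤ using (ℤ; +_; -[1+_])
  import Data.Integer.Properties as ℤ
  open import Data.Maybe using (Maybe; just; nothing)
  open import Data.Product using (_,_)
  open import Data.Sum using (inj₁; inj₂)
  open import Data.Empty using (⊥-elim)
  open import Relation.Nullary using (yes; no)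
  open import Relation.Binary using (tri<; tri≈; tri>)
  open import Relation.Binary.Structures using (IsStrictTotalOrder)
  open import Relation.Binary.PropositionalEquality as ≡ using (_≡_)
  open import Algebra.Bundles using (CommutativeRing)
  open import Algebra.Solver.Ring.AlmostCommutativeRing using (fromCommutativeRing; _-Raw-AlmostCommutative⟶_)
  import Algebra.Solver.Ring
  open IntegerDifferences

  open CompleteOrderedField R
  open IsStrictTotalOrder isStrictTotalOrder public
    using (compare; irrefl) renaming (trans to <-trans; <-respʳ-≈ to <-respʳ; <-respˡ-≈ to <-respˡ)

  commutativeRing : CommutativeRing 0ℓ 0ℓ
  commutativeRing = record { isCommutativeRing = isCommutativeRing }

  open CommutativeRing commutativeRing public
    using (setoid; +-cong; +-congˡ; +-congʳ; *-cong; *-congˡ; -‿cong; +-assoc; +-comm;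
           +-identityˡ; +-identityʳ; -‿inverseʳ; zeroˡ; zeroʳ; ring; semiring; +-abelianGroup)
    renaming (refl to ≈-refl; sym to ≈-sym; trans to ≈-trans; reflexive to ≈-reflexive)
  open import Algebra.Properties.Ring ring using (-‿distribˡ-*; -‿distribʳ-*; -‿involutive)
  open import Algebra.Properties.AbelianGroup +-abelianGroup using (⁻¹-∙-comm; ⁻¹-anti-homo‿-)
  open import Algebra.Properties.Semiring.Mult.TCOptimised semiring using (_×_; ×-homo-+; ×1-homo-*)
  open import Relation.Binary.Reasoning.Setoid setoid

  ι : ℕ → Carrier
  ι n = n × 1#

  ι-+ : ∀ a b → ι (a ℕ.+ b) ≈ ι a + ι b
  ι-+ = ×-homo-+ 1#

  ι-* : ∀ a b → ι (a ℕ.* b) ≈ ι a * ι b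
  ι-* = ×1-homo-*

  ι-suc : ∀ n → ι (suc n) ≈ ι n + 1#
  ι-suc n = ≈-trans (ι-+ 1 n) (+-comm 1# (ι n))

  +-sub-cancelʳ : ∀ a b → (a + b) - b ≈ a
  +-sub-cancelʳ a b = begin
    (a + b) + - b ≈⟨ +-assoc a b (- b) ⟩
    a + (b + - b) ≈⟨ +-congˡ (-‿inverseʳ b) ⟩
    a + 0#        ≈⟨ +-identityʳ a ⟩
    a             ∎

  sub-+-cancelˡ : ∀ a b → a - (a + b) ≈ - b
  sub-+-cancelˡ a b = begin
    a + - (a + b)   ≈⟨ +-congˡ (≈-sym (⁻¹-∙-comm a b)) ⟩
    a + (- a + - b) ≈⟨ ≈-sym (+-assoc a (- a) (- b)) ⟩
    (a + - a) + - b ≈⟨ +-congʳ (-‿inverseʳ a) ⟩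
    0# + - b        ≈⟨ +-identityˡ (- b) ⟩
    - b             ∎

  +-interchange : ∀ a b c d → (a + b) + (c + d) ≈ (a + c) + (b + d)
  +-interchange a b c d = begin
    (a + b) + (c + d) ≈⟨ +-assoc a b (c + d) ⟩
    a + (b + (c + d)) ≈⟨ +-congˡ (≈-sym (+-assoc b c d)) ⟩
    a + ((b + c) + d) ≈⟨ +-congˡ (+-congʳ (+-comm b c)) ⟩
    a + ((c + b) + d) ≈⟨ +-congˡ (+-assoc c b d) ⟩
    a + (c + (b + d)) ≈⟨ ≈-sym (+-assoc a c (b + d)) ⟩
    (a + c) + (b + d) ∎

  sub-+-interchange : ∀ a b c d → (a + b) - (c + d) ≈ (a - c) + (b - d)
  sub-+-interchange a b c d = ≈-trans (+-congˡ (≈-sym (⁻¹-∙-comm c d))) (+-interchange a b (- c) (- d))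

  -‿*-‿ : ∀ a b → (- a) * (- b) ≈ a * b
  -‿*-‿ a b = begin
    (- a) * (- b) ≈⟨ ≈-sym (-‿distribˡ-* a (- b)) ⟩
    - (a * - b)   ≈⟨ -‿cong (≈-sym (-‿distribʳ-* a b)) ⟩
    - - (a * b)   ≈⟨ -‿involutive (a * b) ⟩
    a * b         ∎

  sub-*-sub : ∀ a b c d → (a - b) * (c - d) ≈ (a * c + b * d) - (a * d + b * c)
  sub-*-sub a b c d = begin
    (a + - b) * (c + - d)                           ≈⟨ distribʳ (c + - d) a (- b) ⟩
    a * (c + - d) + (- b) * (c + - d)               ≈⟨ +-cong (distribˡ a c (- d)) (distribˡ (- b) c (- d)) ⟩
    (a * c + a * - d) + ((- b) * c + (- b) * (- d))
      ≈⟨ +-cong (+-congˡ (≈-sym (-‿distribʳ-* a d))) (+-cong (≈-sym (-‿distribˡ-* b c)) (-‿*-‿ b d)) ⟩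
    (a * c + - (a * d)) + (- (b * c) + b * d)       ≈⟨ +-congˡ (+-comm (- (b * c)) (b * d)) ⟩
    (a * c + - (a * d)) + (b * d + - (b * c))       ≈⟨ +-interchange (a * c) (- (a * d)) (b * d) (- (b * c)) ⟩
    (a * c + b * d) + (- (a * d) + - (b * c))       ≈⟨ +-congˡ (⁻¹-∙-comm (a * d) (b * c)) ⟩
    (a * c + b * d) + - (a * d + b * c)             ∎
    where open CommutativeRing commutativeRing using (distribˡ; distribʳ)

  ⟦_⟧ : ℤ → Carrier
  ⟦ + n ⟧ = ι n
  ⟦ -[1+ n ] ⟧ = - ι (suc n)

  ⟦⟧-difference : ∀ i {p q} → i ℤ.+ + q ≡ + p → ⟦ i ⟧ ≈ ι p - ι q
  ⟦⟧-difference (+ n) {p} {q} eq with ℤ.+-injective eq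
  ... | ≡.refl = ≈-sym (≈-trans (+-congʳ (ι-+ n q)) (+-sub-cancelʳ (ι n) (ι q)))
  ⟦⟧-difference -[1+ n ] {p} {q} eq with ℤ.+-injective {q} {suc n ℕ.+ p} (≡.sym (neg-difference -[1+ n ] eq))
  ... | ≡.refl = ≈-sym (≈-trans (+-congˡ (-‿cong ι-[1+n+p])) (sub-+-cancelˡ (ι p) (ι (suc n))))
    where
    ι-[1+n+p] : ι (suc n ℕ.+ p) ≈ ι p + ι (suc n)
    ι-[1+n+p] = ≈-trans (ι-+ (suc n) p) (+-comm (ι (suc n)) (ι p))

  ⟦⟧-parts : ∀ i → ⟦ i ⟧ ≈ ι (positivePart i) - ι (negativePart i)
  ⟦⟧-parts i = ⟦⟧-difference i (parts i)

  module _ (i j : ℤ) where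

    private
      pi = positivePart i
      qi = negativePart i
      pj = positivePart j
      qj = negativePart j

    ⟦⟧-+ : ⟦ i ℤ.+ j ⟧ ≈ ⟦ i ⟧ + ⟦ j ⟧
    ⟦⟧-+ = begin
      ⟦ i ℤ.+ j ⟧                   ≈⟨ ⟦⟧-difference (i ℤ.+ j) (+-difference i j (parts i) (parts j)) ⟩
      ι (pi ℕ.+ pj) - ι (qi ℕ.+ qj) ≈⟨ +-cong (ι-+ pi pj) (-‿cong (ι-+ qi qj)) ⟩
      (ι pi + ι pj) - (ι qi + ι qj) ≈⟨ sub-+-interchange (ι pi) (ι pj) (ι qi) (ι qj) ⟩
      (ι pi - ι qi) + (ι pj - ι qj) ≈⟨ ≈-sym (+-cong (⟦⟧-parts i) (⟦⟧-parts j)) ⟩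
      ⟦ i ⟧ + ⟦ j ⟧                 ∎

    ⟦⟧-* : ⟦ i ℤ.* j ⟧ ≈ ⟦ i ⟧ * ⟦ j ⟧
    ⟦⟧-* = begin
      ⟦ i ℤ.* j ⟧
        ≈⟨ ⟦⟧-difference (i ℤ.* j) (*-difference i j (parts i) (parts j)) ⟩
      ι (pi ℕ.* pj ℕ.+ qi ℕ.* qj) - ι (pi ℕ.* qj ℕ.+ qi ℕ.* pj)
        ≈⟨ +-cong (ι-*+* pi pj qi qj) (-‿cong (ι-*+* pi qj qi pj)) ⟩
      (ι pi * ι pj + ι qi * ι qj) - (ι pi * ι qj + ι qi * ι pj)
        ≈⟨ ≈-sym (sub-*-sub (ι pi) (ι qi) (ι pj) (ι qj)) ⟩
      (ι pi - ι qi) * (ι pj - ι qj)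
        ≈⟨ ≈-sym (*-cong (⟦⟧-parts i) (⟦⟧-parts j)) ⟩
      ⟦ i ⟧ * ⟦ j ⟧ ∎
      where
      ι-*+* : ∀ a b c d → ι (a ℕ.* b ℕ.+ c ℕ.* d) ≈ ι a * ι b + ι c * ι d
      ι-*+* a b c d = ≈-trans (ι-+ (a ℕ.* b) (c ℕ.* d)) (+-cong (ι-* a b) (ι-* c d))

  ⟦⟧-neg : ∀ i → ⟦ ℤ.- i ⟧ ≈ - ⟦ i ⟧
  ⟦⟧-neg i = begin
    ⟦ ℤ.- i ⟧       ≈⟨ ⟦⟧-difference (ℤ.- i) (neg-difference i (parts i)) ⟩
    ι qi - ι pi     ≈⟨ ≈-sym (⁻¹-anti-homo‿- (ι pi) (ι qi)) ⟩
    - (ι pi - ι qi) ≈⟨ -‿cong (≈-sym (⟦⟧-parts i)) ⟩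
    - ⟦ i ⟧         ∎
    where
    pi = positivePart i
    qi = negativePart i

  coefficient≟ : ∀ i j → Maybe (⟦ i ⟧ ≈ ⟦ j ⟧)
  coefficient≟ i j with i ℤ.≟ j
  ... | yes ≡.refl = just ≈-refl
  ... | no _ = nothing

  ⟦⟧-morphism : ℤ.+-*-rawRing -Raw-AlmostCommutative⟶ fromCommutativeRing commutativeRing
  ⟦⟧-morphism = record
    { ⟦_⟧ = ⟦_⟧ ; +-homo = ⟦⟧-+ ; *-homo = ⟦⟧-* ; -‿homo = ⟦⟧-neg
    ; 0-homo = ≈-refl ; 1-homo = ≈-refl }

  module Solver = Algebra.Solver.Ring ℤ.+-*-rawRing (fromCommutativeRing commutativeRing) ⟦⟧-morphism coefficient≟
  open Solver public using (solve; _:+_; _:*_; _:-_; _:=_; con)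

  nonNeg-resp : ∀ {x y} → x ≈ y → 0# ≤ x → 0# ≤ y
  nonNeg-resp x≈y (inj₁ 0<x) = inj₁ (<-respʳ x≈y 0<x)
  nonNeg-resp x≈y (inj₂ 0≈x) = inj₂ (≈-trans 0≈x x≈y)

  x<x+y : ∀ {x y} → 0# < y → x < x + y
  x<x+y {x} {y} 0<y = <-respˡ (+-identityˡ x) (<-respʳ (+-comm y x) (+-mono-< x 0<y))

  +-pos-nonNeg : ∀ {x y} → 0# < x → 0# ≤ y → 0# < x + y
  +-pos-nonNeg {x} {y} 0<x (inj₁ 0<y) = <-trans 0<x (x<x+y 0<y)
  +-pos-nonNeg {x} {y} 0<x (inj₂ 0≈y) = <-respʳ (≈-trans (≈-sym (+-identityʳ x)) (+-congˡ 0≈y)) 0<x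

  +-nonNeg : ∀ {x y} → 0# ≤ x → 0# ≤ y → 0# ≤ x + y
  +-nonNeg (inj₁ 0<x) 0≤y = inj₁ (+-pos-nonNeg 0<x 0≤y)
  +-nonNeg {x} {y} (inj₂ 0≈x) 0≤y = nonNeg-resp (≈-trans (≈-sym (+-identityˡ y)) (+-congʳ 0≈x)) 0≤y

  *-nonNeg : ∀ {x y} → 0# ≤ x → 0# ≤ y → 0# ≤ x * y
  *-nonNeg (inj₁ 0<x) (inj₁ 0<y) = inj₁ (*-pos 0<x 0<y)
  *-nonNeg {x} {y} (inj₂ 0≈x) _ = inj₂ (≈-trans (≈-sym (zeroˡ y)) (*-cong 0≈x ≈-refl))
  *-nonNeg {x} {y} (inj₁ _) (inj₂ 0≈y) = inj₂ (≈-trans (≈-sym (zeroʳ x)) (*-congˡ 0≈y))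

  ≤⇒sub-nonNeg : ∀ {x y} → x ≤ y → 0# ≤ y - x
  ≤⇒sub-nonNeg {x} (inj₁ x<y) = inj₁ (<-respˡ (-‿inverseʳ x) (+-mono-< (- x) x<y))
  ≤⇒sub-nonNeg {x} (inj₂ x≈y) = inj₂ (≈-sym (≈-trans (+-congʳ (≈-sym x≈y)) (-‿inverseʳ x)))

  0<1 : 0# < 1#
  0<1 with compare 0# 1#
  ... | tri< 0<1 _ _ = 0<1
  ... | tri≈ _ 0≈1 _ = ⊥-elim (0≉1 0≈1)
  ... | tri> _ _ 1<0 =
    ⊥-elim (irrefl ≈-refl (<-trans (<-respʳ (-‿*-‿ 1# 1#) 0<[-1]*[-1]) (<-respˡ (≈-sym (*-identityˡ 1#)) 1<0)))
    where
    open CommutativeRing commutativeRing using (*-identityˡ)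
    0<-1 : 0# < - 1#
    0<-1 = <-respˡ (-‿inverseʳ 1#) (<-respʳ (+-identityˡ (- 1#)) (+-mono-< (- 1#) 1<0))
    0<[-1]*[-1] : 0# < (- 1#) * (- 1#)
    0<[-1]*[-1] = *-pos 0<-1 0<-1

  ι-nonNeg : ∀ n → 0# ≤ ι n
  ι-suc-pos : ∀ n → 0# < ι (suc n)

  ι-nonNeg zero = inj₂ ≈-refl
  ι-nonNeg (suc n) = inj₁ (ι-suc-pos n)

  ι-suc-pos n = <-respʳ (≈-sym (ι-+ 1 n)) (+-pos-nonNeg 0<1 (ι-nonNeg n))

  ι-mono-< : ∀ {a b} → a ℕ.< b → ι a < ι b
  ι-mono-< {a} a<b with ℕ.m≤n⇒∃[o]m+o≡n a<b
  ... | o , ≡.refl = <-respʳ ι-split (x<x+y (ι-suc-pos o))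
    where
    ι-split : ι a + ι (suc o) ≈ ι (suc a ℕ.+ o)
    ι-split = ≈-trans (≈-sym (ι-+ a (suc o))) (≈-reflexive (≡.cong ι (ℕ.+-suc a o)))

  ι-injective : ∀ a b → ι a ≈ ι b → a ≡ b
  ι-injective a b ιa≈ιb with ℕ.<-cmp a b
  ... | tri< a<b _ _ = ⊥-elim (irrefl ιa≈ιb (ι-mono-< a<b))
  ... | tri≈ _ a≡b _ = a≡b
  ... | tri> _ _ b<a = ⊥-elim (irrefl (≈-sym ιa≈ιb) (ι-mono-< b<a))

  ι-sub-nonNeg : ∀ {a b} → a ℕ.≤ b → 0# ≤ ι b - ι a
  ι-sub-nonNeg {a} a≤b with ℕ.m≤n⇒∃[o]m+o≡n a≤b
  ... | o , ≡.refl =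
    nonNeg-resp (≈-trans (≈-sym (+-sub-cancelʳ (ι o) (ι a))) (+-congʳ (≈-trans (+-comm (ι o) (ι a)) (≈-sym (ι-+ a o)))))
                (ι-nonNeg o)

  one : ∀ {k} → Solver.Polynomial k
  one = con (+ 1)

  convex-nonNeg : ∀ {t α β} → 0# ≤ t → t ≤ 1# → 0# ≤ α → 0# ≤ β → 0# ≤ α + t * (β - α)
  convex-nonNeg {t} {α} {β} 0≤t t≤1 0≤α 0≤β =
    nonNeg-resp (solve 3 (λ t α β → (one :- t) :* α :+ t :* β := α :+ t :* (β :- α)) ≈-refl t α β)
                (+-nonNeg (*-nonNeg (≤⇒sub-nonNeg t≤1) 0≤α) (*-nonNeg 0≤t 0≤β))

  convex-≤ : ∀ {t α β w} → 0# ≤ t → t ≤ 1# → 0# ≤ w - α → 0# ≤ w - β → 0# ≤ w - (α + t * (β - α))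
  convex-≤ {t} {α} {β} {w} 0≤t t≤1 α≤w β≤w =
    nonNeg-resp (solve 4 (λ t α β w → (one :- t) :* (w :- α) :+ t :* (w :- β) := w :- (α :+ t :* (β :- α))) ≈-refl t α β w)
                (+-nonNeg (*-nonNeg (≤⇒sub-nonNeg t≤1) α≤w) (*-nonNeg 0≤t β≤w))

module ParabolicRows (R : CompleteOrderedField) where

  open import Data.Nat as ℕ using (ℕ; suc)
  import Data.Nat.Properties as ℕ
  open import Data.Integer using (+_)
  open import Data.Product using (Σ; _×_; _,_)
  open import Data.Sum using (inj₁)
  open import Data.Empty using (⊥)
  open import Relation.Binary using (tri<; tri≈; tri>)
  open import Relation.Binary.PropositionalEquality as ≡ using (_≡_; _≢_)

  open CompleteOrderedField R
  open OrderedFieldLemmas R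

  orientation : Carrier → Carrier → Carrier → Carrier → Carrier → Carrier → Carrier
  orientation x₁ x₂ x₃ y₁ y₂ y₃ = (x₃ - x₁) * (y₂ - y₁) - (x₂ - x₁) * (y₃ - y₁)

  orientation-cong : ∀ {x₁ x₂ x₃ y₁ y₂ y₃ x₁' x₂' x₃' y₁' y₂' y₃'} →
                     x₁ ≈ x₁' → x₂ ≈ x₂' → x₃ ≈ x₃' → y₁ ≈ y₁' → y₂ ≈ y₂' → y₃ ≈ y₃' →
                     orientation x₁ x₂ x₃ y₁ y₂ y₃ ≈ orientation x₁' x₂' x₃' y₁' y₂' y₃'
  orientation-cong e₁ e₂ e₃ f₁ f₂ f₃ =
    +-cong (*-cong (+-cong e₃ (-‿cong e₁)) (+-cong f₂ (-‿cong f₁)))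
           (-‿cong (*-cong (+-cong e₂ (-‿cong e₁)) (+-cong f₃ (-‿cong f₁))))

  orientation-collinear : ∀ qx qz vx vz s₁ s₂ s₃ →
    orientation (qx + s₁ * vx) (qx + s₂ * vx) (qx + s₃ * vx) (qz + s₁ * vz) (qz + s₂ * vz) (qz + s₃ * vz) ≈ 0#
  orientation-collinear = solve 7 (λ qx qz vx vz s₁ s₂ s₃ →
    ((qx :+ s₃ :* vx) :- (qx :+ s₁ :* vx)) :* ((qz :+ s₂ :* vz) :- (qz :+ s₁ :* vz))
      :- ((qx :+ s₂ :* vx) :- (qx :+ s₁ :* vx)) :* ((qz :+ s₃ :* vz) :- (qz :+ s₁ :* vz)) := con (+ 0))
    ≈-refl

  -- The orientation expands to (2 + ρ + σ)(1 + (w + 1)(ρσ + ρ + σ)) + (w - δ₂)(2 + ρ + σ) + δ₁(1 + σ) + δ₃(1 + ρ).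
  orientation-rows-pos : ∀ {w ρ σ δ₁ δ₂ δ₃} α → 0# ≤ w → 0# ≤ ρ → 0# ≤ σ →
                         0# ≤ δ₁ → 0# ≤ w - δ₂ → 0# ≤ δ₃ →
    0# < orientation ((w + 1#) * α * α + δ₁)
                     ((w + 1#) * (α + (1# + ρ)) * (α + (1# + ρ)) + δ₂)
                     ((w + 1#) * ((α + (1# + ρ)) + (1# + σ)) * ((α + (1# + ρ)) + (1# + σ)) + δ₃)
                     α (α + (1# + ρ)) ((α + (1# + ρ)) + (1# + σ))
  orientation-rows-pos {w} {ρ} {σ} {δ₁} {δ₂} {δ₃} α 0≤w 0≤ρ 0≤σ 0≤δ₁ δ₂≤w 0≤δ₃ =
    <-respʳ
      (solve 7 (λ w α ρ σ δ₁ δ₂ δ₃ →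
        ((one :+ one) :+ (ρ :+ σ)) :* (one :+ (w :+ one) :* ((ρ :* σ :+ ρ) :+ σ))
          :+ ((w :- δ₂) :* ((one :+ one) :+ (ρ :+ σ)) :+ (δ₁ :* (σ :+ one) :+ δ₃ :* (ρ :+ one)))
        := (((w :+ one) :* ((α :+ (one :+ ρ)) :+ (one :+ σ)) :* ((α :+ (one :+ ρ)) :+ (one :+ σ)) :+ δ₃)
              :- ((w :+ one) :* α :* α :+ δ₁))
             :* ((α :+ (one :+ ρ)) :- α)
           :- (((w :+ one) :* (α :+ (one :+ ρ)) :* (α :+ (one :+ ρ)) :+ δ₂) :- ((w :+ one) :* α :* α :+ δ₁))
             :* (((α :+ (one :+ ρ)) :+ (one :+ σ)) :- α))
        ≈-refl w α ρ σ δ₁ δ₂ δ₃)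
      (+-pos-nonNeg
        (*-pos (+-pos-nonNeg 0<2 (+-nonNeg 0≤ρ 0≤σ))
               (+-pos-nonNeg 0<1 (*-nonNeg (+-nonNeg 0≤w 0≤1) (+-nonNeg (+-nonNeg (*-nonNeg 0≤ρ 0≤σ) 0≤ρ) 0≤σ))))
        (+-nonNeg (*-nonNeg δ₂≤w (+-nonNeg (inj₁ 0<2) (+-nonNeg 0≤ρ 0≤σ)))
                  (+-nonNeg (*-nonNeg 0≤δ₁ (+-nonNeg 0≤σ 0≤1)) (*-nonNeg 0≤δ₃ (+-nonNeg 0≤ρ 0≤1)))))
    where
    0≤1 : 0# ≤ 1#
    0≤1 = inj₁ 0<1
    0<2 : 0# < 1# + 1#
    0<2 = +-pos-nonNeg 0<1 0≤1

  open Space R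

  MeetsRow : Carrier → Line → ℕ → Set
  MeetsRow w ((qx , _ , qz) , (vx , _ , vz) , _) b = Σ Carrier λ s → Σ Carrier λ δ →
    (ι b ≈ qz + s * vz) × ((w + 1#) * ι b * ι b + δ ≈ qx + s * vx) × 0# ≤ δ × 0# ≤ w - δ

  module _ {w : Carrier} (ℓ : Line) (0≤w : 0# ≤ w) where

    no-line-meets-three-rows : ∀ a r s → MeetsRow w ℓ a → MeetsRow w ℓ (a ℕ.+ suc r) →
                               MeetsRow w ℓ (a ℕ.+ suc r ℕ.+ suc s) → ⊥
    no-line-meets-three-rows a r s
      (s₁ , δ₁ , z₁ , x₁ , 0≤δ₁ , _) (s₂ , δ₂ , z₂ , x₂ , _ , δ₂≤w) (s₃ , δ₃ , z₃ , x₃ , 0≤δ₃ , _) =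
      irrefl (≈-sym (≈-trans (orientation-cong x₁ (row≈ (a ℕ.+ suc r) β≈ x₂) (row≈ (a ℕ.+ suc r ℕ.+ suc s) γ≈ x₃)
                                                z₁ (≈-trans (≈-sym β≈) z₂) (≈-trans (≈-sym γ≈) z₃))
                             (orientation-collinear _ _ _ _ s₁ s₂ s₃)))
             (orientation-rows-pos (ι a) 0≤w (ι-nonNeg r) (ι-nonNeg s) 0≤δ₁ δ₂≤w 0≤δ₃)
      where
      β≈ : ι (a ℕ.+ suc r) ≈ ι a + (1# + ι r)
      β≈ = ≈-trans (ι-+ a (suc r)) (+-congˡ (ι-+ 1 r))
      γ≈ : ι (a ℕ.+ suc r ℕ.+ suc s) ≈ (ι a + (1# + ι r)) + (1# + ι s)
      γ≈ = ≈-trans (ι-+ (a ℕ.+ suc r) (suc s)) (+-cong β≈ (ι-+ 1 s))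
      row≈ : ∀ h {h' δ x} → ι h ≈ h' → (w + 1#) * ι h * ι h + δ ≈ x → (w + 1#) * h' * h' + δ ≈ x
      row≈ _ h≈ = ≈-trans (+-congʳ (*-cong (*-cong ≈-refl (≈-sym h≈)) (≈-sym h≈)))

    no-line-meets-three-ordered-rows : ∀ {a b c} → a ℕ.< b → b ℕ.< c →
      MeetsRow w ℓ a → MeetsRow w ℓ b → MeetsRow w ℓ c → ⊥
    no-line-meets-three-ordered-rows {a} a<b b<c with ℕ.m≤n⇒∃[o]m+o≡n a<b | ℕ.m≤n⇒∃[o]m+o≡n b<c
    ... | r , ≡.refl | s , ≡.refl = λ ma mb mc →
      no-line-meets-three-rows a r s ma (subst-row (ℕ.+-suc a r) mb)
        (subst-row (≡.trans (ℕ.+-suc (a ℕ.+ suc r) s) (≡.cong (λ x → suc (x ℕ.+ s)) (ℕ.+-suc a r))) mc)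
      where
      subst-row : ∀ {b b'} → b ≡ b' → MeetsRow w ℓ b' → MeetsRow w ℓ b
      subst-row b≡b' = ≡.subst (MeetsRow w ℓ) (≡.sym b≡b')

    no-line-meets-three-distinct-rows : ∀ {a b c} → MeetsRow w ℓ a → MeetsRow w ℓ b → MeetsRow w ℓ c →
                                        a ≢ b → b ≢ c → a ≢ c → ⊥
    no-line-meets-three-distinct-rows {a} {b} {c} ma mb mc a≢b b≢c a≢c with ℕ.<-cmp a b | ℕ.<-cmp b c | ℕ.<-cmp a c
    ... | tri≈ _ a≡b _ | _            | _            = a≢b a≡b
    ... | _            | tri≈ _ b≡c _ | _            = b≢c b≡c
    ... | _            | _            | tri≈ _ a≡c _ = a≢c a≡c
    ... | tri< a<b _ _ | tri< b<c _ _ | _            = no-line-meets-three-ordered-rows a<b b<c ma mb mc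
    ... | tri< _ _ _   | tri> _ _ c<b | tri< a<c _ _ = no-line-meets-three-ordered-rows a<c c<b ma mc mb
    ... | tri< a<b _ _ | tri> _ _ _   | tri> _ _ c<a = no-line-meets-three-ordered-rows c<a a<b mc ma mb
    ... | tri> _ _ b<a | tri< _ _ _   | tri< a<c _ _ = no-line-meets-three-ordered-rows b<a a<c mb ma mc
    ... | tri> _ _ _   | tri< b<c _ _ | tri> _ _ c<a = no-line-meets-three-ordered-rows b<c c<a mb mc ma
    ... | tri> _ _ b<a | tri> _ _ c<b | _            = no-line-meets-three-ordered-rows c<b b<a mc mb ma

  rowPoint : ℕ → ℕ → ℕ → Point
  rowPoint w b i = (ι (suc w ℕ.* b ℕ.* b ℕ.+ i) , 0# , ι b)

  meetsSegment⇒meetsRow : ∀ {w b i j} (ℓ : Line) → i ℕ.≤ w → j ℕ.≤ w →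
                          MeetsSegment ℓ (rowPoint w b i) (rowPoint w b j) → MeetsRow (ι w) ℓ b
  meetsSegment⇒meetsRow {w} {b} {i} {j} ((qx , _ , qz) , (vx , _ , vz) , _) i≤w j≤w (t , s , 0≤t , t≤1 , x≈ , _ , z≈) =
    s , δ , ≈-trans (≈-sym z-const) z≈ , ≈-trans x-split x≈ ,
    convex-nonNeg 0≤t t≤1 (ι-nonNeg i) (ι-nonNeg j) , convex-≤ 0≤t t≤1 (ι-sub-nonNeg i≤w) (ι-sub-nonNeg j≤w)
    where
    δ c : Carrier
    δ = ι i + t * (ι j - ι i)
    c = (ι w + 1#) * ι b * ι b
    z-const : ι b + t * (ι b - ι b) ≈ ι b
    z-const = solve 2 (λ β t → β :+ t :* (β :- β) := β) ≈-refl (ι b) t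
    ι-row : ∀ k → ι (suc w ℕ.* b ℕ.* b ℕ.+ k) ≈ c + ι k
    ι-row k = ≈-trans (ι-+ (suc w ℕ.* b ℕ.* b) k)
                      (+-congʳ (≈-trans (ι-* (suc w ℕ.* b) b)
                                        (*-cong (≈-trans (ι-* (suc w) b) (*-cong (ι-suc w) ≈-refl)) ≈-refl)))
    x-split : c + δ ≈ ι (suc w ℕ.* b ℕ.* b ℕ.+ i) + t * (ι (suc w ℕ.* b ℕ.* b ℕ.+ j) - ι (suc w ℕ.* b ℕ.* b ℕ.+ i))
    x-split = ≈-trans (solve 4 (λ c a₁ a₂ t → c :+ (a₁ :+ t :* (a₂ :- a₁)) := (c :+ a₁) :+ t :* ((c :+ a₂) :- (c :+ a₁)))
                             ≈-refl c (ι i) (ι j) t)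
                      (≈-sym (+-cong (ι-row i) (*-congˡ (+-cong (ι-row j) (-‿cong (ι-row i))))))

open import Data.Nat using (ℕ; suc; _*_; _≤_; NonZero)
open PairEnumeration using (triangular)

module BlockDrawing (R : CompleteOrderedField) {n m : ℕ} (w blocks : ℕ) {{_ : NonZero (triangular (suc w))}}
                    (blocks-fit : blocks * suc w ≤ n) (edges-fit : m ≤ blocks * triangular (suc w)) where

  open import Data.Nat using (zero; _+_; _<_; _<?_; _≟_; z≤n; s≤s)
  open import Data.Nat.Properties
  open import Data.Nat.DivMod using (_/_; _%_; m≡m%n+[m/n]*n; m%n<n; m<n*o⇒m/o<n)
  open import Data.Fin as Fin using (Fin; toℕ; fromℕ<)
  open import Data.Fin.Properties using (toℕ-fromℕ<; toℕ<n; toℕ-injective)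
  open import Data.Product using (_×_; _,_; proj₁; proj₂)
  open import Data.Sum using (_⊎_; inj₁; inj₂)
  open import Relation.Nullary using (¬_; yes; no; contradiction)
  open import Function using (id)
  open import Data.List using (List; []; _∷_; _++_; concatMap; length; upTo; allFin)
  open import Data.List.Properties using (length-++; length-upTo; length-tabulate)
  open import Data.List.Membership.Propositional using (_∈_; lose)
  open import Data.List.Membership.Propositional.Properties using (∈-++⁺ˡ; ∈-++⁺ʳ; ∈-concatMap⁺; ∈-allFin; ∈-upTo⁺)
  open import Data.List.Relation.Unary.Any using (here; there)
  open import Relation.Binary.PropositionalEquality
    using (_≡_; _≢_; refl; sym; trans; cong; cong₂; subst; subst₂; module ≡-Reasoning)

  open PairEnumeration
  open QuotientRemainder
  open OrderedFieldLemmas R using (ι; ι-nonNeg; ι-injective)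
  open ParabolicRows R
  open ListCounting
  open TwoValues
  open Space R using (Point; MeetsSegment; _≈³_)

  E : ℕ
  E = triangular (suc w)

  blockOf slot : Fin m → ℕ
  blockOf e = toℕ e / E
  slot e = toℕ e % E

  slot<E : ∀ e → slot e < E
  slot<E e = m%n<n (toℕ e) E

  toℕ≡slot+blockOf*E : ∀ e → toℕ e ≡ slot e + blockOf e * E
  toℕ≡slot+blockOf*E e = m≡m%n+[m/n]*n (toℕ e) E

  blockOf<blocks : ∀ e → blockOf e < blocks
  blockOf<blocks e = m<n*o⇒m/o<n (<-≤-trans (toℕ<n e) edges-fit)

  pairOf : Fin m → ℕ × ℕ
  pairOf e = unrankPair (suc w) (slot e)

  lower upper : Fin m → ℕ
  lower e = proj₁ (pairOf e)
  upper e = proj₂ (pairOf e)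

  lower<upper : ∀ e → lower e < upper e
  lower<upper e = proj₁ (unrankPair-ranked (suc w) (slot e) (slot<E e))

  upper<k : ∀ e → upper e < suc w
  upper<k e = proj₁ (proj₂ (unrankPair-ranked (suc w) (slot e) (slot<E e)))

  lower<k : ∀ e → lower e < suc w
  lower<k e = <-trans (lower<upper e) (upper<k e)

  vertex : ∀ {i b} → i < suc w → b < blocks → Fin n
  vertex {i} {b} i<k b<blocks =
    fromℕ< (<-≤-trans (+-monoˡ-< (b * suc w) i<k) (≤-trans (*-monoˡ-≤ (suc w) b<blocks) blocks-fit))

  toℕ-vertex : ∀ {i b} (i<k : i < suc w) (b<blocks : b < blocks) → toℕ (vertex i<k b<blocks) ≡ i + b * suc w
  toℕ-vertex _ _ = toℕ-fromℕ< _

  edge : Fin m → Fin n × Fin n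
  edge e = vertex (lower<k e) (blockOf<blocks e) , vertex (upper<k e) (blockOf<blocks e)

  toℕ-lowerEnd : ∀ e → toℕ (proj₁ (edge e)) ≡ lower e + blockOf e * suc w
  toℕ-lowerEnd e = toℕ-vertex (lower<k e) (blockOf<blocks e)

  toℕ-upperEnd : ∀ e → toℕ (proj₂ (edge e)) ≡ upper e + blockOf e * suc w
  toℕ-upperEnd e = toℕ-vertex (upper<k e) (blockOf<blocks e)

  edge-ordered : ∀ e → proj₁ (edge e) Fin.< proj₂ (edge e)
  edge-ordered e = subst₂ _<_ (sym (toℕ-lowerEnd e)) (sym (toℕ-upperEnd e)) (+-monoˡ-< (blockOf e * suc w) (lower<upper e))

  edge-injective : ∀ e f → edge e ≡ edge f → e ≡ f
  edge-injective e f edge-e≡edge-f = toℕ-injective (begin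
    toℕ e                   ≡⟨ toℕ≡slot+blockOf*E e ⟩
    slot e + blockOf e * E  ≡⟨ cong₂ (λ r b → r + b * E) same-slot (proj₁ lower-eq) ⟩
    slot f + blockOf f * E  ≡⟨ toℕ≡slot+blockOf*E f ⟨
    toℕ f                   ∎)
    where
    open ≡-Reasoning
    lower-eq : blockOf e ≡ blockOf f × lower e ≡ lower f
    lower-eq = +-*-injective (blockOf e) (blockOf f) (suc w) (lower<k e) (lower<k f)
                 (trans (sym (toℕ-lowerEnd e)) (trans (cong (λ p → toℕ (proj₁ p)) edge-e≡edge-f) (toℕ-lowerEnd f)))
    upper-eq : blockOf e ≡ blockOf f × upper e ≡ upper f
    upper-eq = +-*-injective (blockOf e) (blockOf f) (suc w) (upper<k e) (upper<k f)
                 (trans (sym (toℕ-upperEnd e)) (trans (cong (λ p → toℕ (proj₂ p)) edge-e≡edge-f) (toℕ-upperEnd f)))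
    same-slot : slot e ≡ slot f
    same-slot = unrankPair-injective (suc w) (slot<E e) (slot<E f) (cong₂ _,_ (proj₂ lower-eq) (proj₂ upper-eq))

  graph : SimpleGraph n m
  graph = record { edge = edge ; ordered = edge-ordered ; injEdges = edge-injective }

  position : Fin n → Point
  position u = rowPoint w (toℕ u / suc w) (toℕ u % suc w)

  position-injective : ∀ u v → u ≢ v → ¬ (position u ≈³ position v)
  position-injective u v u≢v (x≈ , _ , z≈) = u≢v (toℕ-injective (begin
    toℕ u                              ≡⟨ m≡m%n+[m/n]*n (toℕ u) (suc w) ⟩
    toℕ u % suc w + toℕ u / suc w * suc w ≡⟨ cong₂ (λ r b → r + b * suc w) same-offset same-row ⟩
    toℕ v % suc w + toℕ v / suc w * suc w ≡⟨ m≡m%n+[m/n]*n (toℕ v) (suc w) ⟨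
    toℕ v                              ∎))
    where
    open ≡-Reasoning
    same-row : toℕ u / suc w ≡ toℕ v / suc w
    same-row = ι-injective _ _ z≈
    same-offset : toℕ u % suc w ≡ toℕ v % suc w
    same-offset = +-cancelˡ-≡ (suc w * (toℕ v / suc w) * (toℕ v / suc w)) _ _
                    (trans (cong (λ b → suc w * b * b + toℕ u % suc w) (sym same-row)) (ι-injective _ _ x≈))

  drawing : Drawing R n
  drawing = record { pos = position ; distinct = position-injective }

  position-vertex : ∀ {i b} (i<k : i < suc w) (b<blocks : b < blocks) → position (vertex i<k b<blocks) ≡ rowPoint w b i
  position-vertex {i} {b} i<k b<blocks =
    cong₂ (rowPoint w) (trans (cong (_/ suc w) (toℕ-vertex i<k b<blocks)) ([m+kn]/n≡k b (suc w) i<k))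
                       (trans (cong (_% suc w) (toℕ-vertex i<k b<blocks)) ([m+kn]%n≡m b (suc w) i<k))

  meetsEdge⇒meetsRow : ∀ ℓ e → MeetsEdge {R} graph drawing ℓ e → MeetsRow (ι w) ℓ (blockOf e)
  meetsEdge⇒meetsRow ℓ e meets =
    meetsSegment⇒meetsRow {b = blockOf e} ℓ (≤-pred (lower<k e)) (≤-pred (upper<k e))
      (subst₂ (MeetsSegment ℓ) (position-vertex (lower<k e) (blockOf<blocks e)) (position-vertex (upper<k e) (blockOf<blocks e)) meets)

  crossed-blocks-not-distinct : ∀ ℓ e₁ e₂ e₃ → MeetsEdge {R} graph drawing ℓ e₁ → MeetsEdge {R} graph drawing ℓ e₂ →
                                MeetsEdge {R} graph drawing ℓ e₃ → NotPairwiseDistinct (blockOf e₁) (blockOf e₂) (blockOf e₃)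
  crossed-blocks-not-distinct ℓ e₁ e₂ e₃ meets₁ meets₂ meets₃ =
    no-line-meets-three-distinct-rows ℓ (ι-nonNeg w) {blockOf e₁} {blockOf e₂} {blockOf e₃}
      (meetsEdge⇒meetsRow ℓ e₁ meets₁) (meetsEdge⇒meetsRow ℓ e₂ meets₂) (meetsEdge⇒meetsRow ℓ e₃ meets₃)

  edgesInBlockBelow : ℕ → ℕ → List (Fin m)
  edgesInBlockBelow b zero = []
  edgesInBlockBelow b (suc r) with r + b * E <? m
  ... | yes r+bE<m = fromℕ< r+bE<m ∷ edgesInBlockBelow b r
  ... | no _ = edgesInBlockBelow b r

  length-edgesInBlockBelow : ∀ b r → length (edgesInBlockBelow b r) ≤ r
  length-edgesInBlockBelow b zero = z≤n
  length-edgesInBlockBelow b (suc r) with r + b * E <? m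
  ... | yes _ = s≤s (length-edgesInBlockBelow b r)
  ... | no _ = m≤n⇒m≤1+n (length-edgesInBlockBelow b r)

  ∈-edgesInBlockBelow : ∀ e {r} → slot e < r → e ∈ edgesInBlockBelow (blockOf e) r
  ∈-edgesInBlockBelow e {suc r} slot<1+r with slot e ≟ r | r + blockOf e * E <? m
  ... | yes refl | yes r+bE<m = here (toℕ-injective (trans (toℕ≡slot+blockOf*E e) (sym (toℕ-fromℕ< r+bE<m))))
  ... | yes refl | no r+bE≮m = contradiction (subst (_< m) (toℕ≡slot+blockOf*E e) (toℕ<n e)) r+bE≮m
  ... | no slot≢r | yes _ = there (∈-edgesInBlockBelow e (≤∧≢⇒< (≤-pred slot<1+r) slot≢r))
  ... | no slot≢r | no _ = ∈-edgesInBlockBelow e (≤∧≢⇒< (≤-pred slot<1+r) slot≢r)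

  edgesInBlocks : ℕ → ℕ → List (Fin m)
  edgesInBlocks b b' = edgesInBlockBelow b E ++ edgesInBlockBelow b' E

  length-edgesInBlocks : ∀ b b' → length (edgesInBlocks b b') ≤ E + E
  length-edgesInBlocks b b' = ≤-trans (≤-reflexive (length-++ (edgesInBlockBelow b E)))
                                      (+-mono-≤ (length-edgesInBlockBelow b E) (length-edgesInBlockBelow b' E))

  ∈-edgesInBlocks : ∀ e {b b'} → blockOf e ≡ b ⊎ blockOf e ≡ b' → e ∈ edgesInBlocks b b'
  ∈-edgesInBlocks e (inj₁ refl) = ∈-++⁺ˡ (∈-edgesInBlockBelow e (slot<E e))
  ∈-edgesInBlocks e (inj₂ refl) = ∈-++⁺ʳ _ (∈-edgesInBlockBelow e (slot<E e))

  candidates : List (Quad m)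
  candidates = concatMap (λ e → concatMap (λ b → quadruplesWith e (edgesInBlocks (blockOf e) b)) (upTo blocks)) (allFin m)

  length-candidates : length candidates ≤ m * (blocks * ((E + E) * ((E + E) * (E + E))))
  length-candidates =
    length-concatMap-≤ _ {m} (allFin m)
      (λ e → length-concatMap-≤ _ (upTo blocks)
               (λ b → length-quadruplesWith e (edgesInBlocks (blockOf e) b) (length-edgesInBlocks (blockOf e) b))
               (≤-reflexive (length-upTo blocks)))
      (≤-reflexive (length-tabulate id))

  ∈-candidates : ∀ e₁ e₂ e₃ e₄ → TwoValued (blockOf e₁) (blockOf e₂) (blockOf e₃) (blockOf e₄) →
                 (e₁ , e₂ , e₃ , e₄) ∈ candidates
  ∈-candidates e₁ e₂ e₃ e₄ (b , b-is-a-block , in₂ , in₃ , in₄) =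
    ∈-concatMap⁺ _ (lose (∈-allFin e₁) (∈-concatMap⁺ _ (lose (∈-upTo⁺ (b<blocks b-is-a-block))
      (∈-quadruplesWith e₁ (∈-edgesInBlocks e₂ in₂) (∈-edgesInBlocks e₃ in₃) (∈-edgesInBlocks e₄ in₄)))))
    where
    b<blocks : b ≡ blockOf e₂ ⊎ b ≡ blockOf e₃ ⊎ b ≡ blockOf e₄ → b < blocks
    b<blocks (inj₁ refl) = blockOf<blocks e₂
    b<blocks (inj₂ (inj₁ refl)) = blockOf<blocks e₃
    b<blocks (inj₂ (inj₂ refl)) = blockOf<blocks e₄

  crossing∈candidates : ∀ q → IsSpaceCrossing {R} graph drawing q → q ∈ candidates
  crossing∈candidates (e₁ , e₂ , e₃ , e₄) (_ , _ , ℓ , meets₁ , meets₂ , meets₃ , meets₄) =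
    ∈-candidates e₁ e₂ e₃ e₄ (two-valued _≟_ (blockOf e₁) (blockOf e₂) (blockOf e₃) (blockOf e₄)
      (crossed-blocks-not-distinct ℓ e₁ e₂ e₃ meets₁ meets₂ meets₃)
      (crossed-blocks-not-distinct ℓ e₁ e₂ e₄ meets₁ meets₂ meets₄)
      (crossed-blocks-not-distinct ℓ e₁ e₃ e₄ meets₁ meets₃ meets₄))

open import Data.Nat using (zero; _<_; _^_; _≤?_; z≤n; >-nonZero)
open import Data.Nat.Properties
  using (≤-trans; ≤-reflexive; <-trans; <-≤-trans; <-irrefl; *-comm; *-identityʳ; *-identityˡ; *-monoˡ-≤; ≰⇒>)
open import Data.Nat.Combinatorics using (_C_)
open import Data.Nat.DivMod using (n/1≡n)
open import Data.Fin using (Fin; toℕ)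
open import Data.List using (List; []; length; concatMap; allFin)
open import Data.List.Properties using (length-tabulate)
open import Data.List.Membership.Propositional using (_∈_; lose)
open import Data.List.Membership.Propositional.Properties using (∈-concatMap⁺; ∈-allFin)
open import Data.Product using (Σ; _×_; _,_)
open import Data.Empty using (⊥-elim)
open import Function using (id)
open import Relation.Nullary using (yes; no)
open import Relation.Binary.PropositionalEquality using (_≢_; sym; trans)
open PairEnumeration using (triangular≡C2)
open BlockArithmetic using (BlockDesign; sparse-design; dense-bound)
open ListCounting

FewCrossings : CompleteOrderedField → ℕ → ℕ → Set
FewCrossings R m n = Σ (SimpleGraph n m) λ G → Σ (Drawing R n) λ D → Σ (List (Quad m)) λ L →
  (length L * n ^ 4 ≤ 6720 * m ^ 6) × (∀ q → IsSpaceCrossing {R} G D q → q ∈ L)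

-- m disjoint edges, each a block of its own: any three crossed edges would lie in distinct blocks.
matching-drawing : ∀ R {m n} → 2 * m ≤ n → FewCrossings R m n
matching-drawing R {m} {n} 2m≤n = graph , drawing , [] , z≤n , no-crossing
  where
  open BlockDrawing R 1 m (≤-trans (≤-reflexive (*-comm m 2)) 2m≤n) (≤-reflexive (sym (*-identityʳ m)))
  distinct-blocks : ∀ {e f : Fin m} → toℕ e < toℕ f → blockOf e ≢ blockOf f
  distinct-blocks {e} {f} e<f same = <-irrefl (trans (sym (n/1≡n (toℕ e))) (trans same (n/1≡n (toℕ f)))) e<f
  no-crossing : ∀ q → IsSpaceCrossing {R} graph drawing q → q ∈ []
  no-crossing (e₁ , e₂ , e₃ , _) ((e₁<e₂ , e₂<e₃ , _) , _ , ℓ , meets₁ , meets₂ , meets₃ , _) =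
    ⊥-elim (crossed-blocks-not-distinct ℓ e₁ e₂ e₃ meets₁ meets₂ meets₃
              (distinct-blocks e₁<e₂) (distinct-blocks e₂<e₃) (distinct-blocks (<-trans e₁<e₂ e₂<e₃)))

allQuadruples : ∀ m → List (Quad m)
allQuadruples m = concatMap (λ e → quadruplesWith e (allFin m)) (allFin m)

length-allQuadruples : ∀ m → length (allQuadruples m) ≤ m * (m * (m * m))
length-allQuadruples m =
  length-concatMap-≤ _ {m} (allFin m) (λ e → length-quadruplesWith e (allFin m) |allFin|≤m) |allFin|≤m
  where
  |allFin|≤m : length (allFin m) ≤ m
  |allFin|≤m = ≤-reflexive (length-tabulate id)

∈-allQuadruples : ∀ {m} (q : Quad m) → q ∈ allQuadruples m
∈-allQuadruples {m} (e₁ , e₂ , e₃ , e₄) =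
  ∈-concatMap⁺ _ (lose (∈-allFin e₁) (∈-quadruplesWith e₁ (∈-allFin e₂) (∈-allFin e₃) (∈-allFin e₄)))

complete-drawing : ∀ R {m} w → 1 ≤ m → m ≤ suc w C 2 → suc w * suc w ≤ 81 * m → FewCrossings R m (suc w)
complete-drawing R {m} w m≥1 m≤C n²≤81m =
  graph , drawing , allQuadruples m ,
  ≤-trans (*-monoˡ-≤ (suc w ^ 4) (length-allQuadruples m)) (dense-bound m (suc w) n²≤81m) ,
  λ q _ → ∈-allQuadruples q
  where
  m≤E : m ≤ triangular (suc w)
  m≤E = ≤-trans m≤C (≤-reflexive (sym (triangular≡C2 (suc w))))
  open BlockDrawing R w 1 {{>-nonZero (<-≤-trans m≥1 m≤E)}} (≤-reflexive (*-identityˡ (suc w)))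
                    (≤-trans m≤E (≤-reflexive (sym (*-identityˡ (triangular (suc w))))))

block-design-drawing : ∀ R {m n} → BlockDesign m n → FewCrossings R m n
block-design-drawing R {m} {n} design =
  graph , drawing , candidates , ≤-trans (*-monoˡ-≤ (n ^ 4) length-candidates) few-candidates , crossing∈candidates
  where
  open BlockDesign design
  open BlockDrawing R w blocks {{pairs-nonZero}} blocks-fit edges-fit

theorem2 : (R : CompleteOrderedField) (m n : ℕ) → 1 ≤ m → 1 ≤ n → m ≤ n C 2 →
    Σ (SimpleGraph n m) λ G → Σ (Drawing R n) λ D → Σ (List (Quad m)) λ L →
      (length L * n ^ 4 ≤ 6720 * m ^ 6) × (∀ q → IsSpaceCrossing {R} G D q → q ∈ L)
theorem2 R m zero _ () _
theorem2 R m (suc w) m≥1 n≥1 m≤C with 2 * m ≤? suc w | suc w * suc w ≤? 81 * m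
... | yes 2m≤n | _          = matching-drawing R 2m≤n
... | no 2m≰n  | yes n²≤81m = complete-drawing R w m≥1 m≤C n²≤81m
... | no 2m≰n  | no n²≰81m  = block-design-drawing R (sparse-design m≥1 n≥1 (≰⇒> 2m≰n) (≰⇒> n²≰81m))
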